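{- Let $m,n$ be positive integers with $m \equiv 0 \pmod 4$ and $n \equiv 0 \pmod 4$. Then $K_m \Box K_n$ has an $L_8$-decomposition.
   Context: $K_m$ is the complete graph on $m$ vertices. The Cartesian product $G \Box H$ has vertex set $V(G)\times V(H)$, with $(g,h)$ adjacent to $(g',h')$ iff either $g=g'$ and $hh'\in E(H)$, or $h=h'$ and $gg'\in E(G)$. The sunlet graph $L_8$ is the graph on 8 vertices $x_1,\dots,x_8$ with edge set $\{x_1x_2,x_2x_3,x_3x_4,x_4x_1,x_1x_5,x_2x_6,x_3x_7,x_4x_8\}$. An $L_8$-decomposition of a graph $G$ is a partition of $E(G)$ into sets each inducing a subgraph isomorphic to $L_8$. -}

module Defs where

open import Data.Nat using (ℕ)
open import Data.Fin using (Fin; zero; suc)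
open import Data.Product using (Σ; _×_; _,_; proj₁; proj₂)
open import Data.Sum using (_⊎_)
open import Relation.Binary.PropositionalEquality using (_≡_; _≢_)
open import Function.Definitions using (Injective)

Vtx : ℕ → ℕ → Set
Vtx m n = Fin m × Fin n

Adj : ∀ {m n} → Vtx m n → Vtx m n → Set
Adj (g , h) (g' , h') = (g ≡ g' × h ≢ h') ⊎ (h ≡ h' × g ≢ g')

-- The sunlet graph L_8 on vertices x1..x8 (indexed 0..7); its 8 edges.
L8edge : Fin 8 → Fin 8 × Fin 8
L8edge zero = zero , (suc zero)
L8edge (suc zero) = (suc zero) , (suc (suc zero))
L8edge (suc (suc zero)) = (suc (suc zero)) , (suc (suc (suc zero)))
L8edge (suc (suc (suc zero))) = (suc (suc (suc zero))) , zero
L8edge (suc (suc (suc (suc zero)))) = zero , (suc (suc (suc (suc zero))))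
L8edge (suc (suc (suc (suc (suc zero))))) = (suc zero) , (suc (suc (suc (suc (suc zero)))))
L8edge (suc (suc (suc (suc (suc (suc zero)))))) = (suc (suc zero)) , (suc (suc (suc (suc (suc (suc zero))))))
L8edge (suc (suc (suc (suc (suc (suc (suc zero))))))) = (suc (suc (suc zero))) , (suc (suc (suc (suc (suc (suc (suc zero)))))))

record L8Copy (m n : ℕ) : Set where
  field
    vmap     : Fin 8 → Vtx m n
    injective : Injective _≡_ _≡_ vmap
    edges    : ∀ e → Adj (vmap (proj₁ (L8edge e))) (vmap (proj₂ (L8edge e)))

CoversEdge : ∀ {m n} → L8Copy m n → Fin 8 → Vtx m n → Vtx m n → Set
CoversEdge c e u v =
  (f (proj₁ (L8edge e)) ≡ u × f (proj₂ (L8edge e)) ≡ v)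
  ⊎ (f (proj₁ (L8edge e)) ≡ v × f (proj₂ (L8edge e)) ≡ u)
  where f = L8Copy.vmap c

record L8Decomposition (m n : ℕ) : Set where
  field
    size    : ℕ
    copies  : Fin size → L8Copy m n
    covered : ∀ u v → Adj u v → Σ (Fin size × Fin 8) λ p →
                CoversEdge (copies (proj₁ p)) (proj₂ p) u v
    unique  : ∀ u v → Adj u v → (p q : Fin size × Fin 8) →
                CoversEdge (copies (proj₁ p)) (proj₂ p) u v →
                CoversEdge (copies (proj₁ q)) (proj₂ q) u v → p ≡ q

module Submission where

-- Write m = 4a, n = 4b and index the vertices of K_{4a} □ K_{4b} as
-- ((i , x) , (j , y)) with block coordinates i < a, j < b and offsets x, y < 4.
-- Every edge then lies in exactly one of three kinds of subgraph:
--   * a block {i} × Fin 4 × {j} × Fin 4, a copy of K₄ □ K₄;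
--   * a row bridge: the edges of a fixed row (i , x) between two column
--     blocks j < j', a copy of the complete bipartite graph K_{4,4};
--   * a column bridge, the same with rows and columns exchanged.
-- K₄ □ K₄ (48 edges, 6 copies) and K_{4,4} (16 edges, 2 copies) have explicit
-- L₈-decompositions, verified by a decision procedure.

open import Data.Nat using (ℕ; zero; suc; _+_; _*_; _%_; _/_; _>_)
open import Data.Nat.DivMod using (m≡m%n+[m/n]*n)
open import Data.Fin using (Fin; _<_; _<?_)
open import Data.Fin.Patterns using (0F; 1F; 2F; 3F)
open import Data.Fin.Properties
  using (_≟_; <-cmp; <-irrefl; <-asym; suc-injective; all?; any?; +↔⊎; *↔×; 0↔⊥)
open import Data.Vec using (Vec; []; _∷_; lookup)
open import Data.Product using (Σ; ∃₂; _×_; _,_; proj₁; proj₂; map₁; swap)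
open import Data.Product.Properties using (≡-dec)
open import Data.Product.Function.NonDependent.Propositional using (_×-↔_)
open import Data.Sum using (_⊎_; inj₁; inj₂)
open import Data.Sum.Function.Propositional using (_⊎-↔_)
open import Data.Empty using (⊥; ⊥-elim)
open import Data.Unit using (tt)
open import Function.Base using (_∘_)
open import Function.Bundles using (_↔_; Inverse; Injection)
open import Function.Construct.Identity using (↔-id)
open import Function.Construct.Composition using (_↔-∘_)
open import Function.Construct.Symmetry using (↔-sym)
open import Function.Definitions using (Injective)
open import Function.Properties.Inverse using (↔⇒↣)
open import Relation.Binary.Definitions using (DecidableEquality; tri<; tri≈; tri>)
open import Relation.Binary.PropositionalEquality
open import Relation.Nullary using (Dec; yes; no; ¬_)
open import Relation.Nullary.Decidable using (toWitness; map′; _×-dec_; _⊎-dec_; _→-dec_; ¬?)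
open import Defs

Graph : Set → Set₁
Graph V = V → V → Set

module _ {V : Set} where

  Symmetric : Graph V → Set
  Symmetric E = ∀ u v → E u v → E v u

  _⊆_ : Graph V → Graph V → Set
  E ⊆ F = ∀ {u v} → E u v → F u v

  Disjoint : Graph V → Graph V → Set
  Disjoint E F = ∀ {u v} → E u v → F u v → ⊥

  _∪_ : Graph V → Graph V → Graph V
  (E ∪ F) u v = E u v ⊎ F u v

  ⋃ : {I : Set} → (I → Graph V) → Graph V
  ⋃ {I} F u v = Σ I λ i → F i u v

  PairwiseDisjoint : {I : Set} → (I → Graph V) → Set
  PairwiseDisjoint F = ∀ {i j u v} → F i u v → F j u v → i ≡ j

  ∪-symmetric : {E F : Graph V} → Symmetric E → Symmetric F → Symmetric (E ∪ F)
  ∪-symmetric E-sym F-sym u v (inj₁ uv) = inj₁ (E-sym u v uv)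
  ∪-symmetric E-sym F-sym u v (inj₂ uv) = inj₂ (F-sym u v uv)

  ⋃-symmetric : {I : Set} {F : I → Graph V} → (∀ i → Symmetric (F i)) → Symmetric (⋃ F)
  ⋃-symmetric F-sym u v (i , uv) = i , F-sym i u v uv

Image : {V W : Set} → (V → W) → Graph V → Graph W
Image φ E w w' = ∃₂ λ u v → φ u ≡ w × φ v ≡ w' × E u v

image-symmetric : {V W : Set} {φ : V → W} {E : Graph V} → Symmetric E → Symmetric (Image φ E)
image-symmetric E-sym _ _ (u , v , φu≡w , φv≡w' , uv) = v , u , φv≡w' , φu≡w , E-sym u v uv

-- K_X □ K_Y: two vertices are adjacent iff they agree in exactly one coordinate.
-- For X = Fin m, Y = Fin n this is definitionally the relation Adj of Defs.
Cartesian : {X Y : Set} → Graph (X × Y)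
Cartesian (g , h) (g' , h') = (g ≡ g' × h ≢ h') ⊎ (h ≡ h' × g ≢ g')

cartesian-symmetric : {X Y : Set} → Symmetric (Cartesian {X} {Y})
cartesian-symmetric _ _ (inj₁ (g≡g' , h≢h')) = inj₁ (sym g≡g' , h≢h' ∘ sym)
cartesian-symmetric _ _ (inj₂ (h≡h' , g≢g')) = inj₂ (sym h≡h' , g≢g' ∘ sym)

-- The complete bipartite graph K_{s,s}; the second coordinate is the side.
Bipartite : {s : ℕ} → Graph (Fin s × Fin 2)
Bipartite (_ , σ) (_ , τ) = σ ≢ τ

bipartite-symmetric : {s : ℕ} → Symmetric (Bipartite {s})
bipartite-symmetric _ _ σ≢τ = σ≢τ ∘ sym

src tgt : Fin 8 → Fin 8
src e = proj₁ (L8edge e)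
tgt e = proj₂ (L8edge e)

record Copy {V : Set} (E : Graph V) : Set where
  field
    vmap      : Fin 8 → V
    injective : Injective _≡_ _≡_ vmap
    edges     : ∀ e → E (vmap (src e)) (vmap (tgt e))
open Copy

Covers : {V : Set} → (Fin 8 → V) → Fin 8 → V → V → Set
Covers f e u v = (f (src e) ≡ u × f (tgt e) ≡ v) ⊎ (f (src e) ≡ v × f (tgt e) ≡ u)

covers-flip : {V : Set} {f : Fin 8 → V} {e : Fin 8} {u v : V} → Covers f e u v → Covers f e v u
covers-flip (inj₁ (fs≡u , ft≡v)) = inj₂ (fs≡u , ft≡v)
covers-flip (inj₂ (fs≡v , ft≡u)) = inj₁ (fs≡v , ft≡u)

covers⇒edge : {V : Set} {E : Graph V} → Symmetric E → (c : Copy E) (e : Fin 8) →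
              ∀ {u v} → Covers (vmap c) e u v → E u v
covers⇒edge E-sym c e (inj₁ (refl , refl)) = edges c e
covers⇒edge E-sym c e (inj₂ (refl , refl)) = E-sym _ _ (edges c e)

Finite : Set → Set
Finite A = Σ ℕ λ k → Fin k ↔ A

↔-injective : {A B : Set} (ι : A ↔ B) → Injective _≡_ _≡_ (Inverse.to ι)
↔-injective ι = Injection.injective (↔⇒↣ ι)

finite-Fin : ∀ k → Finite (Fin k)
finite-Fin k = k , ↔-id (Fin k)

finite-⊥ : Finite ⊥
finite-⊥ = 0 , 0↔⊥

finite-⊎ : {A B : Set} → Finite A → Finite B → Finite (A ⊎ B)
finite-⊎ (k , ι) (l , κ) = k + l , (ι ⊎-↔ κ) ↔-∘ +↔⊎

finite-× : {A B : Set} → Finite A → Finite B → Finite (A × B)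
finite-× (k , ι) (l , κ) = k * l , (ι ×-↔ κ) ↔-∘ *↔×

record Decomposition {V : Set} (E : Graph V) : Set₁ where
  field
    Index   : Set
    finite  : Finite Index
    copy    : Index → Copy E
    covered : ∀ u v → E u v → Σ (Index × Fin 8) λ p → Covers (vmap (copy (proj₁ p))) (proj₂ p) u v
    unique  : ∀ u v (p q : Index × Fin 8) →
              Covers (vmap (copy (proj₁ p))) (proj₂ p) u v →
              Covers (vmap (copy (proj₁ q))) (proj₂ q) u v → p ≡ q
open Decomposition

module _ {V : Set} where

  weaken : {E F : Graph V} → E ⊆ F → Copy E → Copy F
  weaken E⊆F c = record { vmap = vmap c ; injective = injective c ; edges = E⊆F ∘ edges c }

  empty : {E : Graph V} → (∀ {u v} → ¬ E u v) → Decomposition E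
  empty no-edge = record
    { Index = ⊥ ; finite = finite-⊥ ; copy = λ ()
    ; covered = λ _ _ uv → ⊥-elim (no-edge uv)
    ; unique = λ { _ _ (() , _) } }

  reshape : {E F : Graph V} → E ⊆ F → F ⊆ E → Decomposition E → Decomposition F
  reshape E⊆F F⊆E d = record
    { Index = Index d ; finite = finite d ; copy = weaken E⊆F ∘ copy d
    ; covered = λ u v uv → covered d u v (F⊆E uv) ; unique = unique d }

  union : {E F : Graph V} → Symmetric E → Symmetric F → Disjoint E F →
          Decomposition E → Decomposition F → Decomposition (E ∪ F)
  union {E} {F} E-sym F-sym disjoint dE dF = record
    { Index = Index dE ⊎ Index dF ; finite = finite-⊎ (finite dE) (finite dF)
    ; copy = copy′ ; covered = covered′ ; unique = unique′ }
    where
    copy′ : Index dE ⊎ Index dF → Copy (E ∪ F)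
    copy′ (inj₁ i) = weaken inj₁ (copy dE i)
    copy′ (inj₂ i) = weaken inj₂ (copy dF i)

    covered′ : ∀ u v → (E ∪ F) u v → Σ _ λ p → Covers (vmap (copy′ (proj₁ p))) (proj₂ p) u v
    covered′ u v (inj₁ uv) = let ((i , e) , c) = covered dE u v uv in (inj₁ i , e) , c
    covered′ u v (inj₂ uv) = let ((i , e) , c) = covered dF u v uv in (inj₂ i , e) , c

    unique′ : ∀ u v p q → Covers (vmap (copy′ (proj₁ p))) (proj₂ p) u v →
              Covers (vmap (copy′ (proj₁ q))) (proj₂ q) u v → p ≡ q
    unique′ u v (inj₁ i , e) (inj₁ j , e') c c' = cong (map₁ inj₁) (unique dE u v (i , e) (j , e') c c')
    unique′ u v (inj₂ i , e) (inj₂ j , e') c c' = cong (map₁ inj₂) (unique dF u v (i , e) (j , e') c c')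
    unique′ u v (inj₁ i , e) (inj₂ j , e') c c' =
      ⊥-elim (disjoint (covers⇒edge E-sym (copy dE i) e c) (covers⇒edge F-sym (copy dF j) e' c'))
    unique′ u v (inj₂ i , e) (inj₁ j , e') c c' =
      ⊥-elim (disjoint (covers⇒edge E-sym (copy dE j) e' c') (covers⇒edge F-sym (copy dF i) e c))

  bigUnion-Fin : ∀ k (F : Fin k → Graph V) → (∀ i → Symmetric (F i)) → PairwiseDisjoint F →
                 (∀ i → Decomposition (F i)) → Decomposition (⋃ F)
  bigUnion-Fin zero F _ _ _ = empty λ { (() , _) }
  bigUnion-Fin (suc k) F F-sym disjoint d =
    reshape merge split
      (union (F-sym 0F) (⋃-symmetric (F-sym ∘ Fin.suc)) head-disjoint (d 0F)
        (bigUnion-Fin k (F ∘ Fin.suc) (F-sym ∘ Fin.suc) (λ x y → suc-injective (disjoint x y)) (d ∘ Fin.suc)))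
    where
    head-disjoint : Disjoint (F 0F) (⋃ (F ∘ Fin.suc))
    head-disjoint x (i , y) with disjoint x y
    ... | ()

    merge : (F 0F ∪ ⋃ (F ∘ Fin.suc)) ⊆ ⋃ F
    merge (inj₁ x) = 0F , x
    merge (inj₂ (i , x)) = Fin.suc i , x

    split : ⋃ F ⊆ (F 0F ∪ ⋃ (F ∘ Fin.suc))
    split (0F , x) = inj₁ x
    split (Fin.suc i , x) = inj₂ (i , x)

  bigUnion : {I : Set} → Finite I → (F : I → Graph V) → (∀ i → Symmetric (F i)) →
             PairwiseDisjoint F → (∀ i → Decomposition (F i)) → Decomposition (⋃ F)
  bigUnion (k , ι) F F-sym disjoint d =
    reshape (λ (n , x) → to n , x) reindex
      (bigUnion-Fin k (F ∘ to) (F-sym ∘ to) (λ x y → ↔-injective ι (disjoint x y)) (d ∘ to))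
    where
    open Inverse ι
    reindex : ⋃ F ⊆ ⋃ (F ∘ to)
    reindex {u} {v} (i , x) = from i , subst (λ j → F j u v) (sym (strictlyInverseˡ i)) x

image : {V W : Set} {φ : V → W} {E : Graph V} → Injective _≡_ _≡_ φ →
        Decomposition E → Decomposition (Image φ E)
image {φ = φ} {E} φ-injective d = record
  { Index = Index d ; finite = finite d ; copy = copy′ ; covered = covered′ ; unique = unique′ }
  where
  copy′ : Index d → Copy (Image φ E)
  copy′ i = record
    { vmap = φ ∘ vmap (copy d i)
    ; injective = injective (copy d i) ∘ φ-injective
    ; edges = λ e → _ , _ , refl , refl , edges (copy d i) e }

  push : ∀ f e {u v} → Covers f e u v → Covers (φ ∘ f) e (φ u) (φ v)
  push _ _ (inj₁ (fs≡u , ft≡v)) = inj₁ (cong φ fs≡u , cong φ ft≡v)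
  push _ _ (inj₂ (fs≡v , ft≡u)) = inj₂ (cong φ fs≡v , cong φ ft≡u)

  pull : ∀ f e {u v} → Covers (φ ∘ f) e (φ u) (φ v) → Covers f e u v
  pull _ _ (inj₁ (fs≡u , ft≡v)) = inj₁ (φ-injective fs≡u , φ-injective ft≡v)
  pull _ _ (inj₂ (fs≡v , ft≡u)) = inj₂ (φ-injective fs≡v , φ-injective ft≡u)

  covered′ : ∀ w w' → Image φ E w w' → Σ _ λ p → Covers (vmap (copy′ (proj₁ p))) (proj₂ p) w w'
  covered′ _ _ (u , v , refl , refl , uv) =
    let ((i , e) , c) = covered d u v uv in (i , e) , push (vmap (copy d i)) e c

  -- Both pairs cover an edge in the image; pull it back to a common edge of E.
  unique′ : ∀ w w' p q → Covers (vmap (copy′ (proj₁ p))) (proj₂ p) w w' →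
            Covers (vmap (copy′ (proj₁ q))) (proj₂ q) w w' → p ≡ q
  unique′ _ _ p@(i , e) q@(j , e') c@(inj₁ (refl , refl)) c' =
    unique d _ _ p q (pull (vmap (copy d i)) e c) (pull (vmap (copy d j)) e' c')
  unique′ _ _ p@(i , e) q@(j , e') c@(inj₂ (refl , refl)) c' =
    unique d _ _ p q (pull (vmap (copy d i)) e c) (pull (vmap (copy d j)) e' c')

cartesian-↔ : {X X' Y Y' : Set} → X ↔ X' → Y ↔ Y' →
              Decomposition (Cartesian {X} {Y}) → Decomposition (Cartesian {X'} {Y'})
cartesian-↔ {X} {X'} {Y} {Y'} ι κ d = reshape forward backward (image φ-injective d)
  where
  open Inverse
  φ : X × Y → X' × Y'
  φ (g , h) = to ι g , to κ h

  φ-injective : Injective _≡_ _≡_ φ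
  φ-injective eq = cong₂ _,_ (↔-injective ι (cong proj₁ eq)) (↔-injective κ (cong proj₂ eq))

  forward : Image φ Cartesian ⊆ Cartesian
  forward (_ , _ , refl , refl , inj₁ (refl , h≢h')) = inj₁ (refl , h≢h' ∘ ↔-injective κ)
  forward (_ , _ , refl , refl , inj₂ (refl , g≢g')) = inj₂ (refl , g≢g' ∘ ↔-injective ι)

  backward : Cartesian ⊆ Image φ Cartesian
  backward {g , h} {g' , h'} uv =
    (from ι g , from κ h) , (from ι g' , from κ h') ,
    cong₂ _,_ (strictlyInverseˡ ι g) (strictlyInverseˡ κ h) ,
    cong₂ _,_ (strictlyInverseˡ ι g') (strictlyInverseˡ κ h') , preimage uv
    where
    preimage : Cartesian (g , h) (g' , h') → Cartesian (from ι g , from κ h) (from ι g' , from κ h')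
    preimage (inj₁ (refl , h≢h')) = inj₁ (refl , h≢h' ∘ ↔-injective (↔-sym κ))
    preimage (inj₂ (refl , g≢g')) = inj₂ (refl , g≢g' ∘ ↔-injective (↔-sym ι))

toL8Decomposition : ∀ {m n} → Decomposition (Cartesian {Fin m} {Fin n}) → L8Decomposition m n
toL8Decomposition d = record
  { size = k ; copies = copy′ ; covered = covered′
  ; unique = λ u v _ p q c c' → index-injective (unique d u v (map₁ to p) (map₁ to q) c c') }
  where
  k = proj₁ (finite d)
  open Inverse (proj₂ (finite d))

  copy′ : Fin k → L8Copy _ _
  copy′ i = record
    { vmap = vmap (copy d (to i)) ; injective = injective (copy d (to i)) ; edges = edges (copy d (to i)) }

  covered′ : ∀ u v → Adj u v → Σ (Fin k × Fin 8) λ p → CoversEdge (copy′ (proj₁ p)) (proj₂ p) u v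
  covered′ u v uv =
    let ((i , e) , c) = covered d u v uv
    in (from i , e) , subst (λ j → Covers (vmap (copy d j)) e u v) (sym (strictlyInverseˡ i)) c

  index-injective : ∀ {p q : Fin k × Fin 8} → map₁ to p ≡ map₁ to q → p ≡ q
  index-injective eq = cong₂ _,_ (↔-injective (proj₂ (finite d)) (cong proj₁ eq)) (cong proj₂ eq)

all-pairs? : ∀ {p q} {P : Fin p × Fin q → Set} → (∀ u → Dec (P u)) → Dec (∀ u → P u)
all-pairs? P? = map′ (λ h (g , g') → h g g') (λ h g g' → h (g , g'))
                     (all? λ g → all? λ g' → P? (g , g'))

-- Decompositions of a small graph on Fin p × Fin q by an explicit list of k
-- vertex maps vm, justified by a finite check.
module Certified {p q k : ℕ} (E : Graph (Fin p × Fin q)) (E? : ∀ u v → Dec (E u v))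
                 (vm : Fin k → Fin 8 → Fin p × Fin q) where

  private
    _≟V_ : DecidableEquality (Fin p × Fin q)
    _≟V_ = ≡-dec _≟_ _≟_

  covers? : ∀ c e u v → Dec (Covers (vm c) e u v)
  covers? c e u v = (vm c (src e) ≟V u ×-dec vm c (tgt e) ≟V v)
             ⊎-dec (vm c (src e) ≟V v ×-dec vm c (tgt e) ≟V u)

  record Certificate : Set where
    field
      maps-edges     : ∀ c e → E (vm c (src e)) (vm c (tgt e))
      maps-injective : ∀ c i j → vm c i ≡ vm c j → i ≡ j
      edge-disjoint  : ∀ c e c' e' → Covers (vm c') e' (vm c (src e)) (vm c (tgt e)) → (c , e) ≡ (c' , e')
      complete       : ∀ u v → E u v → ∃₂ λ c e → Covers (vm c) e u v
  open Certificate

  certificate? : Dec Certificate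
  certificate? = map′ (λ (h₁ , h₂ , h₃ , h₄) → record
                        { maps-edges = h₁ ; maps-injective = h₂ ; edge-disjoint = h₃ ; complete = h₄ })
                      (λ cert → maps-edges cert , maps-injective cert , edge-disjoint cert , complete cert)
    (  (all? λ c → all? λ e → E? (vm c (src e)) (vm c (tgt e)))
    ×-dec (all? λ c → all? λ i → all? λ j → (vm c i ≟V vm c j) →-dec (i ≟ j))
    ×-dec (all? λ c → all? λ e → all? λ c' → all? λ e' →
             covers? c' e' (vm c (src e)) (vm c (tgt e)) →-dec ≡-dec _≟_ _≟_ (c , e) (c' , e'))
    ×-dec (all-pairs? λ u → all-pairs? λ v → E? u v →-dec any? λ c → any? λ e → covers? c e u v))

  decomposition : Certificate → Decomposition E
  decomposition cert = record
    { Index = Fin k ; finite = finite-Fin k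
    ; copy = λ c → record { vmap = vm c ; injective = maps-injective cert c _ _ ; edges = maps-edges cert c }
    ; covered = λ u v uv → let (c , e , cv) = complete cert u v uv in (c , e) , cv
    ; unique = unique′ }
    where
    unique′ : ∀ u v (x y : Fin k × Fin 8) → Covers (vm (proj₁ x)) (proj₂ x) u v →
              Covers (vm (proj₁ y)) (proj₂ y) u v → x ≡ y
    unique′ _ _ (c , e) (c' , e') (inj₁ (refl , refl)) cv = edge-disjoint cert c e c' e' cv
    unique′ _ _ (c , e) (c' , e') (inj₂ (refl , refl)) cv =
      edge-disjoint cert c e c' e' (covers-flip {f = vm c'} {e'} cv)

cartesian? : ∀ {p q} (u v : Fin p × Fin q) → Dec (Cartesian u v)
cartesian? (g , h) (g' , h') = (g ≟ g' ×-dec ¬? (h ≟ h')) ⊎-dec (h ≟ h' ×-dec ¬? (g ≟ g'))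

bipartite? : ∀ {s} (u v : Fin s × Fin 2) → Dec (Bipartite u v)
bipartite? (_ , σ) (_ , τ) = ¬? (σ ≟ τ)

-- Six copies of L₈ partitioning the 48 edges of K₄ □ K₄ (each row lists the images of x₁, …, x₈).
k4□k4-copies : Vec (Vec (Fin 4 × Fin 4) 8) 6
k4□k4-copies =
  ((0F , 0F) ∷ (2F , 0F) ∷ (2F , 2F) ∷ (0F , 2F) ∷ (0F , 1F) ∷ (2F , 1F) ∷ (3F , 2F) ∷ (0F , 3F) ∷ []) ∷
  ((1F , 2F) ∷ (2F , 2F) ∷ (2F , 3F) ∷ (1F , 3F) ∷ (3F , 2F) ∷ (2F , 1F) ∷ (0F , 3F) ∷ (1F , 0F) ∷ []) ∷
  ((0F , 1F) ∷ (1F , 1F) ∷ (1F , 2F) ∷ (0F , 2F) ∷ (0F , 3F) ∷ (2F , 1F) ∷ (1F , 0F) ∷ (3F , 2F) ∷ []) ∷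
  ((0F , 0F) ∷ (0F , 3F) ∷ (3F , 3F) ∷ (3F , 0F) ∷ (1F , 0F) ∷ (1F , 3F) ∷ (3F , 2F) ∷ (2F , 0F) ∷ []) ∷
  ((2F , 1F) ∷ (3F , 1F) ∷ (3F , 3F) ∷ (2F , 3F) ∷ (0F , 1F) ∷ (3F , 2F) ∷ (1F , 3F) ∷ (2F , 0F) ∷ []) ∷
  ((1F , 0F) ∷ (1F , 1F) ∷ (3F , 1F) ∷ (3F , 0F) ∷ (2F , 0F) ∷ (1F , 3F) ∷ (0F , 1F) ∷ (3F , 2F) ∷ []) ∷ []

k4,4-copies : Vec (Vec (Fin 4 × Fin 2) 8) 2
k4,4-copies =
  ((0F , 0F) ∷ (0F , 1F) ∷ (1F , 0F) ∷ (2F , 1F) ∷ (3F , 1F) ∷ (3F , 0F) ∷ (1F , 1F) ∷ (2F , 0F) ∷ []) ∷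
  ((1F , 1F) ∷ (2F , 0F) ∷ (3F , 1F) ∷ (3F , 0F) ∷ (0F , 0F) ∷ (0F , 1F) ∷ (1F , 0F) ∷ (2F , 1F) ∷ []) ∷ []

k4□k4 : Decomposition (Cartesian {Fin 4} {Fin 4})
k4□k4 = decomposition (toWitness {a? = certificate?} tt)
  where open Certified Cartesian cartesian? (lookup ∘ lookup k4□k4-copies)

k4,4 : Decomposition (Bipartite {4})
k4,4 = decomposition (toWitness {a? = certificate?} tt)
  where open Certified Bipartite bipartite? (lookup ∘ lookup k4,4-copies)

-- endpoint j j' σ: side σ of a bridge between blocks j and j' lies in block j or j'.
endpoint : ∀ {n} → Fin n → Fin n → Fin 2 → Fin n
endpoint j j' 0F = j
endpoint j j' 1F = j'

endpoint-injective : ∀ {n} {j j' : Fin n} {σ τ : Fin 2} → j < j' →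
                     endpoint j j' σ ≡ endpoint j j' τ → σ ≡ τ
endpoint-injective {σ = 0F} {0F} _ _ = refl
endpoint-injective {σ = 0F} {1F} j<j' j≡j' = ⊥-elim (<-irrefl j≡j' j<j')
endpoint-injective {σ = 1F} {0F} j<j' j'≡j = ⊥-elim (<-irrefl (sym j'≡j) j<j')
endpoint-injective {σ = 1F} {1F} _ _ = refl

endpoints-unique : ∀ {n} {j j' k k' : Fin n} {σ τ σ' τ' : Fin 2} → j < j' → k < k' → σ ≢ τ → σ' ≢ τ' →
                   endpoint j j' σ ≡ endpoint k k' σ' → endpoint j j' τ ≡ endpoint k k' τ' → (j , j') ≡ (k , k')
endpoints-unique {σ = 0F} {0F} _ _ σ≢τ _ _ _ = ⊥-elim (σ≢τ refl)
endpoints-unique {σ = 1F} {1F} _ _ σ≢τ _ _ _ = ⊥-elim (σ≢τ refl)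
endpoints-unique {σ' = 0F} {0F} _ _ _ σ'≢τ' _ _ = ⊥-elim (σ'≢τ' refl)
endpoints-unique {σ' = 1F} {1F} _ _ _ σ'≢τ' _ _ = ⊥-elim (σ'≢τ' refl)
endpoints-unique {σ = 0F} {1F} {0F} {1F} _ _ _ _ j≡k j'≡k' = cong₂ _,_ j≡k j'≡k'
endpoints-unique {σ = 1F} {0F} {1F} {0F} _ _ _ _ j'≡k' j≡k = cong₂ _,_ j≡k j'≡k'
endpoints-unique {σ = 0F} {1F} {1F} {0F} j<j' k<k' _ _ refl refl = ⊥-elim (<-asym j<j' k<k')
endpoints-unique {σ = 1F} {0F} {0F} {1F} j<j' k<k' _ _ refl refl = ⊥-elim (<-asym j<j' k<k')

-- Row bridges in K_X □ K_{ns}, whose second coordinate is split into n blocks of size s.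
module _ {X : Set} {n s : ℕ} where

  bridge : X → Fin n → Fin n → Fin s × Fin 2 → X × (Fin n × Fin s)
  bridge r j j' (y , σ) = r , (endpoint j j' σ , y)

  RowBridge : X × (Fin n × Fin n) → Graph (X × (Fin n × Fin s))
  RowBridge (r , j , j') u v = j < j' × Image (bridge r j j') Bipartite u v

  RowBridges : Graph (X × (Fin n × Fin s))
  RowBridges = ⋃ RowBridge

  -- The two sides of a bridge land in different blocks, so the bridge embeds K_{s,s}.
  bridge-injective : ∀ {r j j'} → j < j' → Injective _≡_ _≡_ (bridge r j j')
  bridge-injective j<j' eq =
    cong₂ _,_ (cong (proj₂ ∘ proj₂) eq) (endpoint-injective j<j' (cong (proj₁ ∘ proj₂) eq))

  rowBridge-symmetric : ∀ i → Symmetric (RowBridge i)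
  rowBridge-symmetric _ u v (j<j' , uv) = j<j' , image-symmetric bipartite-symmetric u v uv

  rowBridges-symmetric : Symmetric RowBridges
  rowBridges-symmetric = ⋃-symmetric rowBridge-symmetric

  rowBridge-decomposition : Decomposition (Bipartite {s}) → ∀ i → Decomposition (RowBridge i)
  rowBridge-decomposition d (r , j , j') with j <? j'
  ... | yes j<j' = reshape (j<j' ,_) proj₂ (image (bridge-injective j<j') d)
  ... | no j≮j' = empty (j≮j' ∘ proj₁)

  -- An edge of a bridge determines its row and, by endpoints-unique, its two blocks.
  rowBridge-disjoint : PairwiseDisjoint RowBridge
  rowBridge-disjoint (j<j' , _ , _ , refl , refl , σ≢τ) (k<k' , _ , _ , eq , eq' , σ'≢τ') =
    cong₂ _,_ (cong proj₁ (sym eq))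
      (endpoints-unique j<j' k<k' σ≢τ σ'≢τ' (cong (proj₁ ∘ proj₂) (sym eq)) (cong (proj₁ ∘ proj₂) (sym eq')))

  rowBridges-decomposition : Finite X → Decomposition (Bipartite {s}) → Decomposition RowBridges
  rowBridges-decomposition finite-X d =
    bigUnion (finite-× finite-X (finite-× (finite-Fin n) (finite-Fin n)))
             RowBridge rowBridge-symmetric rowBridge-disjoint (rowBridge-decomposition d)

  rowBridges-shape : ∀ {u v} → RowBridges u v → proj₁ u ≡ proj₁ v × proj₁ (proj₂ u) ≢ proj₁ (proj₂ v)
  rowBridges-shape (_ , j<j' , _ , _ , refl , refl , σ≢τ) = refl , σ≢τ ∘ endpoint-injective j<j'

  rowBridges-complete : ∀ {r j j' y y'} → j ≢ j' → RowBridges (r , (j , y)) (r , (j' , y'))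
  rowBridges-complete {r} {j} {j'} {y} {y'} j≢j' with <-cmp j j'
  ... | tri< j<j' _ _ = (r , j , j') , j<j' , (y , 0F) , (y' , 1F) , refl , refl , λ ()
  ... | tri≈ _ j≡j' _ = ⊥-elim (j≢j' j≡j')
  ... | tri> _ _ j'<j = (r , j' , j) , j'<j , (y , 1F) , (y' , 0F) , refl , refl , λ ()

-- K_{as} □ K_{bs}, vertices ((i , x) , (j , y)) with blocks i < a, j < b and offsets x, y < s.
module _ (a b : ℕ) {s : ℕ} where

  block : Fin a → Fin b → Fin s × Fin s → (Fin a × Fin s) × (Fin b × Fin s)
  block i j (x , y) = (i , x) , (j , y)

  blockOf : (Fin a × Fin s) × (Fin b × Fin s) → Fin a × Fin b
  blockOf ((i , _) , (j , _)) = i , j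

  Block : Fin a × Fin b → Graph ((Fin a × Fin s) × (Fin b × Fin s))
  Block (i , j) = Image (block i j) Cartesian

  Blocks : Graph ((Fin a × Fin s) × (Fin b × Fin s))
  Blocks = ⋃ Block

  ColumnBridges : Graph ((Fin a × Fin s) × (Fin b × Fin s))
  ColumnBridges = Image swap (RowBridges {Fin b × Fin s} {a} {s})

  block-symmetric : ∀ i → Symmetric (Block i)
  block-symmetric _ = image-symmetric cartesian-symmetric

  blocks-symmetric : Symmetric Blocks
  blocks-symmetric = ⋃-symmetric block-symmetric

  columnBridges-symmetric : Symmetric ColumnBridges
  columnBridges-symmetric = image-symmetric rowBridges-symmetric

  -- Each block carries a copy of the decomposition of K_s □ K_s; distinct blocks share no vertex.

  blocks-decomposition : Decomposition (Cartesian {Fin s} {Fin s}) → Decomposition Blocks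
  blocks-decomposition d =
    bigUnion (finite-× (finite-Fin a) (finite-Fin b)) Block
      block-symmetric block-disjoint (λ _ → image block-injective d)
    where
    block-injective : ∀ {i j} → Injective _≡_ _≡_ (block i j)
    block-injective eq = cong₂ _,_ (cong (proj₂ ∘ proj₁) eq) (cong (proj₂ ∘ proj₂) eq)

    block-disjoint : PairwiseDisjoint Block
    block-disjoint (_ , _ , refl , refl , _) (_ , _ , eq , _ , _) = cong blockOf (sym eq)

  blocks-shape : ∀ {u v} → Blocks u v → blockOf u ≡ blockOf v
  blocks-shape (_ , _ , _ , refl , refl , _) = refl

  blocks⇒cartesian : Blocks ⊆ Cartesian
  blocks⇒cartesian (_ , _ , _ , refl , refl , inj₁ (refl , y≢y')) = inj₁ (refl , y≢y' ∘ cong proj₂)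
  blocks⇒cartesian (_ , _ , _ , refl , refl , inj₂ (refl , x≢x')) = inj₂ (refl , x≢x' ∘ cong proj₂)

  cartesian⇒blocks : ∀ {u v} → Cartesian u v → blockOf u ≡ blockOf v → Blocks u v
  cartesian⇒blocks {(i , x) , (j , y)} {(_ , x') , (_ , y')} uv refl =
    (i , j) , (x , y) , (x' , y') , refl , refl , inside uv
    where
    inside : Cartesian ((i , x) , (j , y)) ((i , x') , (j , y')) → Cartesian (x , y) (x' , y')
    inside (inj₁ (refl , jy≢jy')) = inj₁ (refl , jy≢jy' ∘ cong (j ,_))
    inside (inj₂ (refl , ix≢ix')) = inj₂ (refl , ix≢ix' ∘ cong (i ,_))

  columnBridges-shape : ∀ {u v} → ColumnBridges u v →
                        proj₂ u ≡ proj₂ v × proj₁ (proj₁ u) ≢ proj₁ (proj₁ v)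
  columnBridges-shape (_ , _ , refl , refl , uv) = rowBridges-shape uv

  Pieces : Graph ((Fin a × Fin s) × (Fin b × Fin s))
  Pieces = Blocks ∪ (RowBridges ∪ ColumnBridges)

  cartesian⇒pieces : Cartesian ⊆ Pieces
  cartesian⇒pieces {_ , (j , _)} {_ , (j' , _)} uv@(inj₁ (refl , _)) with j ≟ j'
  ... | yes refl = inj₁ (cartesian⇒blocks uv refl)
  ... | no j≢j' = inj₂ (inj₁ (rowBridges-complete j≢j'))
  cartesian⇒pieces {(i , _) , _} {(i' , _) , _} uv@(inj₂ (refl , _)) with i ≟ i'
  ... | yes refl = inj₁ (cartesian⇒blocks uv refl)
  ... | no i≢i' = inj₂ (inj₂ (_ , _ , refl , refl , rowBridges-complete i≢i'))

  pieces⇒cartesian : Pieces ⊆ Cartesian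
  pieces⇒cartesian (inj₁ uv) = blocks⇒cartesian uv
  pieces⇒cartesian (inj₂ (inj₁ uv)) =
    let (same-row , other-block) = rowBridges-shape uv in inj₁ (same-row , other-block ∘ cong proj₁)
  pieces⇒cartesian (inj₂ (inj₂ uv)) =
    let (same-column , other-block) = columnBridges-shape uv in inj₂ (same-column , other-block ∘ cong proj₁)

  -- The three kinds of piece are edge-disjoint, since they differ in how the block changes.
  blocks-bridges-disjoint : Disjoint Blocks (RowBridges ∪ ColumnBridges)
  blocks-bridges-disjoint b (inj₁ r) = proj₂ (rowBridges-shape r) (cong proj₂ (blocks-shape b))
  blocks-bridges-disjoint b (inj₂ c) = proj₂ (columnBridges-shape c) (cong proj₁ (blocks-shape b))

  rows-columns-disjoint : Disjoint RowBridges ColumnBridges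
  rows-columns-disjoint r c = proj₂ (columnBridges-shape c) (cong proj₁ (proj₁ (rowBridges-shape r)))

  blowUp : Decomposition (Cartesian {Fin s} {Fin s}) → Decomposition (Bipartite {s}) →
           Decomposition (Cartesian {Fin a × Fin s} {Fin b × Fin s})
  blowUp dBlock dBridge =
    reshape pieces⇒cartesian cartesian⇒pieces
      (union blocks-symmetric (∪-symmetric rowBridges-symmetric columnBridges-symmetric)
        blocks-bridges-disjoint (blocks-decomposition dBlock)
        (union rowBridges-symmetric columnBridges-symmetric rows-columns-disjoint
          (rowBridges-decomposition (finite-× (finite-Fin a) (finite-Fin s)) dBridge)
          (image (cong swap) (rowBridges-decomposition (finite-× (finite-Fin b) (finite-Fin s)) dBridge))))

quotient*4 : ∀ m → m % 4 ≡ 0 → m ≡ (m / 4) * 4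
quotient*4 m m%4≡0 = trans (m≡m%n+[m/n]*n m 4) (cong (_+ (m / 4) * 4) m%4≡0)

-- Theorem: write m = 4a, n = 4b, blow up the base decompositions of K₄ □ K₄ and K_{4,4}
-- to K_{4a} □ K_{4b}, and renumber Fin a × Fin 4 as Fin (4a).
lemma2p2 : (m n : ℕ) → m > 0 → n > 0 → m % 4 ≡ 0 → n % 4 ≡ 0 →
    L8Decomposition m n
lemma2p2 m n _ _ m%4≡0 n%4≡0 =
  subst₂ L8Decomposition (sym (quotient*4 m m%4≡0)) (sym (quotient*4 n n%4≡0))
    (toL8Decomposition (cartesian-↔ (↔-sym *↔×) (↔-sym *↔×) (blowUp (m / 4) (n / 4) k4□k4 k4,4)))
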